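{- Let $k\in\mathbb{N}_0$ and let $F$ be a clause-set with $\mathrm{whd}(F)\le k$. Then there is a clause-set $F'$ such that: (1) $F'\subseteq\mathrm{prc}_0(F)$ and $F'$ is equivalent to $F$; (2) there is an injection $i:F'\to F$ with $C\subseteq i(C)$ for all $C\in F'$; (3) $\mathrm{whd}(F')\le k$; (4) $F'$ is a transversal of $\mathcal{T}_k(F)$.
   Context: Clauses are finite sets of literals without complementary pair; clause-sets finite sets of clauses. $\varphi*F$ removes satisfied clauses and falsified literals. $\mathrm{prc}_0(F)$: prime implicates of $F$ (inclusion-minimal implied clauses); clause-sets are equivalent iff they have the same prime implicates. $\overline{C}$: complements of the literals of $C$. W-hardness $\mathrm{whd}(F)$: for unsatisfiable $F$ the minimum $k$ such that a resolution tree deriving the empty clause from $F$ exists where each resolution step has a parent clause of length $\le k$; $\mathrm{whd}$ of the empty clause-set is $0$; for satisfiable nonempty $F$ the maximum of $\mathrm{whd}(\varphi*F)$ over $\varphi$ with $\varphi*F$ unsatisfiable. Trigger hypergraph $\mathcal{T}_k(F)$: vertex set $\mathrm{prc}_0(F)$, hyperedges $E^k_C:=\{C'\in\mathrm{prc}_0(F): C'\cap\overline{C}=\emptyset,\ |C'\setminus C|\le k\}$ for all $C\in\mathrm{prc}_0(F)$. A transversal is a set of vertices meeting every hyperedge. -}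

module Defs where

open import Data.Nat using (ℕ; _≤_) renaming (_≟_ to _≟ℕ_)
open import Data.Bool using (Bool; true; false; not; _∧_) renaming (_≟_ to _≟𝔹_)
open import Data.Maybe using (Maybe; just; nothing)
open import Data.Product using (Σ; ∃; ∃-syntax; _×_; _,_)
open import Data.Product.Properties using (≡-dec)
open import Data.Sum using (_⊎_)
open import Data.Empty using (⊥)
open import Data.Fin using (Fin)
open import Data.List using (List; []; length; map; filter; filterᵇ; lookup)
open import Data.Bool.ListAction using (any)
open import Data.List.Membership.Propositional using (_∈_)
open import Data.List.Relation.Binary.Subset.Propositional using (_⊆_)
open import Data.List.Relation.Unary.All using (All)
open import Data.List.Relation.Unary.Any using (Any)
open import Data.List.Relation.Unary.AllPairs using (AllPairs)
open import Data.List.Relation.Unary.Unique.Propositional using (Unique)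
open import Relation.Nullary using (¬_; ¬?)
open import Relation.Binary.PropositionalEquality using (_≡_; _≢_)
open import Relation.Binary.Definitions using (DecidableEquality)
open import Function using (Injective; _⇔_)

-- A literal is a variable (a natural number) with a sign
-- (true = positive literal v, false = negative literal ¬v).
Lit : Set
Lit = ℕ × Bool

compl : Lit → Lit
compl (v , b) = (v , not b)

_≟L_ : DecidableEquality Lit
_≟L_ = ≡-dec _≟ℕ_ _≟𝔹_

-- Clauses are represented by duplicate-free lists of literals (so that
-- 'length' is the cardinality |C|), read as finite sets via membership.
Clause : Set
Clause = List Lit

IsClause : Clause → Set
IsClause C = Unique C × (∀ x → x ∈ C → compl x ∈ C → ⊥)

_≋_ : Clause → Clause → Set
C ≋ D = (C ⊆ D) × (D ⊆ C)

ClauseSet : Set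
ClauseSet = List Clause

IsClauseSet : ClauseSet → Set
IsClauseSet F = All IsClause F × AllPairs (λ C D → ¬ (C ≋ D)) F

Assignment : Set
Assignment = ℕ → Bool

SatLit : Assignment → Lit → Set
SatLit α (v , b) = α v ≡ b

SatClause : Assignment → Clause → Set
SatClause α C = Any (SatLit α) C

SatCls : Assignment → ClauseSet → Set
SatCls α F = All (SatClause α) F

Satisfiable : ClauseSet → Set
Satisfiable F = ∃[ α ] SatCls α F

Unsatisfiable : ClauseSet → Set
Unsatisfiable F = ∀ α → ¬ SatCls α F

_⊨_ : ClauseSet → Clause → Set
F ⊨ C = ∀ α → SatCls α F → SatClause α C

Equivalent : ClauseSet → ClauseSet → Set
Equivalent F G = ∀ α → SatCls α F ⇔ SatCls α G

IsPrimeImplicate : ClauseSet → Clause → Set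
IsPrimeImplicate F C =
  IsClause C × F ⊨ C ×
  (∀ D → IsClause D → D ⊆ C → F ⊨ D → C ⊆ D)

PartialAssignment : Set
PartialAssignment = ℕ → Maybe Bool

eqᵇ : Bool → Bool → Bool
eqᵇ true b = b
eqᵇ false b = not b

litTrue : PartialAssignment → Lit → Bool
litTrue φ (v , b) with φ v
... | just a = eqᵇ a b
... | nothing = false

litFalse : PartialAssignment → Lit → Bool
litFalse φ (v , b) with φ v
... | just a = not (eqᵇ a b)
... | nothing = false

-- φ * F: remove satisfied clauses, remove falsified literals
-- (result as a list; possible duplicates are irrelevant for
-- (un)satisfiability and refutability)
_*_ : PartialAssignment → ClauseSet → ClauseSet
φ * F = map (filterᵇ (λ x → not (litFalse φ x)))
            (filterᵇ (λ C → not (any (litTrue φ) C)) F)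

Resolvent : Lit → Clause → Clause → Clause → Set
Resolvent x C₁ C₂ R =
  x ∈ C₁ × compl x ∈ C₂ × IsClause R ×
  (∀ y → y ∈ R ⇔ ((y ∈ C₁ × y ≢ x) ⊎ (y ∈ C₂ × y ≢ compl x)))

data Deriv (k : ℕ) (F : ClauseSet) : Clause → Set where
  axiom : ∀ {C} → C ∈ F → Deriv k F C
  res   : ∀ {x C₁ C₂ R} → Deriv k F C₁ → Deriv k F C₂ →
          Resolvent x C₁ C₂ R → (length C₁ ≤ k ⊎ length C₂ ≤ k) →
          Deriv k F R

Refutable : ℕ → ClauseSet → Set
Refutable k F = Deriv k F []

-- whd(F) ≤ k, following the definition of w-hardness:
--  * unsatisfiable F: a refutation of width-parameter k exists
--    (whd is the minimum such k);
--  * satisfiable F (including the empty clause-set, whd = 0): every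
--    unsatisfiable φ * F has whd ≤ k (whd is the maximum of these).
WhdLe : ClauseSet → ℕ → Set
WhdLe F k =
  (Unsatisfiable F → Refutable k F) ×
  (Satisfiable F → ∀ φ → Unsatisfiable (φ * F) → Refutable k (φ * F))

open import Data.List.Membership.DecPropositional _≟L_ using (_∈?_)

diffSize : Clause → Clause → ℕ
diffSize C' C = length (filter (λ x → ¬? (x ∈? C)) C')

-- C' ∈ E^k_C  (given C' ∈ prc₀(F))
InHyperedge : ℕ → Clause → Clause → Set
InHyperedge k C C' = (∀ x → x ∈ C' → compl x ∈ C → ⊥) × diffSize C' C ≤ k

IsTransversal : ℕ → ClauseSet → ClauseSet → Set
IsTransversal k F G =
  All (IsPrimeImplicate F) G ×
  (∀ C → IsPrimeImplicate F C →
     ∃[ C' ] (C' ∈ G × IsPrimeImplicate F C' × InHyperedge k C C'))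

-- Replace every clause of F by a prime implicate contained in it and drop repetitions. The
-- resulting F′ subsumes F and is implied by F, hence equivalent to it; and subsumption turns a
-- width-k resolution tree over F (or over φ * F) into one over F′ (or φ * F′), because shrinking
-- the parents of a resolution step never widens it. For the transversal property take a prime
-- implicate C and let φ falsify C: φ * F′ is unsatisfiable, so a width-k refutation of it has an
-- axiom of length ≤ k, and that axiom is the restriction under φ of a clause C′ ∈ F′ that contains
-- no complement of a literal of C and has |C′ ∖ C| ≤ k. Constructively, finding prime implicates
-- and the case split on the satisfiability of F′ rely on deciding entailment, which is done by
-- enumerating the assignments of the finitely many variables involved.

module Submission where

open import Defs

open import Data.Bool using (Bool; true; false; not; T) renaming (_≟_ to _≟𝔹_)
open import Data.Bool.ListAction using (any)
open import Data.Bool.Properties using (not-¬; ¬-not; not-involutive)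
open import Data.Empty using (⊥; ⊥-elim)
open import Data.Fin using (Fin; zero; suc)
open import Data.Fin.Properties using (suc-injective)
open import Data.List using (List; []; _∷_; _++_; length; lookup; map; concat; filter; filterᵇ)
open import Data.List.Properties using (filter-notAll; filter-≐)
open import Data.List.Membership.Propositional using (_∈_; _∉_; find; lose)
open import Data.List.Membership.Propositional.Properties
  using (∈-map⁺; ∈-++⁺ˡ; ∈-++⁺ʳ; ∈-++⁻; ∈-concat⁺′; ∈-filter⁺; ∈-filter⁻; ∈-map∘filter⁺; ∈-map∘filter⁻)
open import Data.List.Membership.DecPropositional _≟L_ using (_∈?_)
open import Data.List.Relation.Binary.Subset.Propositional using (_⊆_)
open import Data.List.Relation.Binary.Subset.Propositional.Properties
  using (Any-resp-⊆; ⊆[]⇒≡[]; filter-⊆; filter⁺′)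
open import Data.List.Relation.Binary.Subset.DecPropositional _≟L_ using (_⊆?_)
open import Data.List.Relation.Binary.Sublist.Heterogeneous using (Sublist; []; _∷ʳ_; _∷_)
open import Data.List.Relation.Unary.All as All using (All; []; _∷_; all?)
open import Data.List.Relation.Unary.Any using (here; there; any?)
open import Data.List.Relation.Unary.Any.Properties using (any⁺; any⁻)
open import Data.List.Relation.Unary.AllPairs using (AllPairs; []; _∷_)
open import Data.List.Relation.Unary.Unique.Propositional using (Unique)
import Data.List.Relation.Unary.Unique.Propositional.Properties as Unique
open import Data.Maybe using (just; nothing)
open import Data.Nat using (ℕ; _≤_; _<_; z≤n; s≤s) renaming (_≟_ to _≟ℕ_)
open import Data.Nat.Properties using (≤-refl; ≤-trans; <-≤-trans)
open import Data.Product using (Σ; ∃; ∃-syntax; _×_; _,_; proj₁; proj₂; map₁)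
open import Data.Sum using (_⊎_; inj₁; inj₂)
import Data.Sum as Sum
open import Data.Unit using (tt)
open import Function using (_∘_; id; Injective; _⇔_; mk⇔; Equivalence)
open import Relation.Nullary using (¬_; Dec; yes; no; ¬?)
open import Relation.Nullary.Decidable using (T?; _×-dec_; decidable-stable)
open import Relation.Binary.PropositionalEquality using (_≡_; _≢_; refl; sym; trans; subst; cong)

open Equivalence using (to; from)

T-not : ∀ {b} → T (not b) ⇔ (¬ T b)
T-not {true}  = mk⇔ (λ ()) (λ ¬t → ¬t tt)
T-not {false} = mk⇔ (λ _ ()) (λ _ → tt)

T-eqᵇ : ∀ a b → T (eqᵇ a b) ⇔ just a ≡ just b
T-eqᵇ true  true  = mk⇔ (λ _ → refl) (λ _ → tt)
T-eqᵇ true  false = mk⇔ (λ ()) (λ ())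
T-eqᵇ false true  = mk⇔ (λ ()) (λ ())
T-eqᵇ false false = mk⇔ (λ _ → refl) (λ _ → tt)

T-litTrue : ∀ φ v b → T (litTrue φ (v , b)) ⇔ φ v ≡ just b
T-litTrue φ v b with φ v
... | just a  = T-eqᵇ a b
... | nothing = mk⇔ (λ ()) (λ ())

T-litFalse : ∀ φ v b → T (litFalse φ (v , b)) ⇔ φ v ≡ just (not b)
T-litFalse φ v b with φ v
... | just true  = T-eqᵇ true (not b)
... | just false = T-eqᵇ false (not b)
... | nothing    = mk⇔ (λ ()) (λ ())

unassigned : ∀ φ v b → ¬ T (litTrue φ (v , b)) → ¬ T (litFalse φ (v , b)) → φ v ≡ nothing
unassigned φ v b ¬true ¬false = by-value (φ v) refl
  where
  by-value : ∀ m → φ v ≡ m → φ v ≡ nothing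
  by-value nothing eq = eq
  by-value (just a) eq with a ≟𝔹 b
  ... | yes refl = ⊥-elim (¬true (from (T-litTrue φ v a) eq))
  ... | no a≢b   = ⊥-elim (¬false (from (T-litFalse φ v b) (trans eq (cong just (¬-not a≢b)))))

extend : PartialAssignment → Assignment → Assignment
extend φ α v with φ v
... | just a  = a
... | nothing = α v

extend-assigned : ∀ φ {α} v {a} → φ v ≡ just a → extend φ α v ≡ a
extend-assigned φ v eq with φ v
extend-assigned φ v refl | just a = refl

extend-unassigned : ∀ φ {α} v → φ v ≡ nothing → extend φ α v ≡ α v
extend-unassigned φ v eq with φ v
extend-unassigned φ v refl | nothing = refl

litTrue-sat : ∀ φ {α} x → T (litTrue φ x) → SatLit (extend φ α) x
litTrue-sat φ (v , b) t = extend-assigned φ v (to (T-litTrue φ v b) t)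

litFalse-unsat : ∀ φ {α} x → T (litFalse φ x) → ¬ SatLit (extend φ α) x
litFalse-unsat φ (v , b) t sat =
  not-¬ refl (trans (sym sat) (extend-assigned φ v (to (T-litFalse φ v b) t)))

kept? : ∀ φ x → Dec (T (not (litFalse φ x)))
kept? φ x = T? (not (litFalse φ x))

restrict : PartialAssignment → Clause → Clause
restrict φ = filter (kept? φ)

Untouched : PartialAssignment → Clause → Set
Untouched φ C = T (not (any (litTrue φ) C))

untouched? : ∀ φ C → Dec (Untouched φ C)
untouched? φ C = T? (not (any (litTrue φ) C))

∈-*⁻ : ∀ φ {G D} → D ∈ φ * G → ∃[ C ] (C ∈ G × D ≡ restrict φ C × Untouched φ C)
∈-*⁻ φ = ∈-map∘filter⁻ (restrict φ) (untouched? φ)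

∈-*⁺ : ∀ φ {G C} → C ∈ G → Untouched φ C → restrict φ C ∈ φ * G
∈-*⁺ φ C∈G untouched = ∈-map∘filter⁺ (restrict φ) (untouched? φ) (_ , C∈G , refl , untouched)

untouched-lit : ∀ φ {C x} → Untouched φ C → x ∈ C → ¬ T (litTrue φ x)
untouched-lit φ untouched x∈C t = to T-not untouched (any⁺ (litTrue φ) (lose x∈C t))

untouched-⊆ : ∀ φ {C C′} → Untouched φ C → C′ ⊆ C → Untouched φ C′
untouched-⊆ φ {C′ = C′} untouched C′⊆C = from T-not λ t →
  let (x , x∈C′ , tx) = find (any⁻ (litTrue φ) C′ t)
  in untouched-lit φ untouched (C′⊆C x∈C′) tx

sat-restrict⇔ : ∀ φ {α C} → Untouched φ C → SatClause (extend φ α) C ⇔ SatClause α (restrict φ C)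
sat-restrict⇔ φ {α} {C} untouched = mk⇔ forward backward
  where
  forward : SatClause (extend φ α) C → SatClause α (restrict φ C)
  forward sat with find sat
  ... | (v , b) , x∈C , satx =
    lose (∈-filter⁺ (kept? φ) x∈C (from T-not ¬false))
         (trans (sym (extend-unassigned φ v (unassigned φ v b (untouched-lit φ untouched x∈C) ¬false)))
                satx)
    where
    ¬false : ¬ T (litFalse φ (v , b))
    ¬false t = litFalse-unsat φ (v , b) t satx

  backward : SatClause α (restrict φ C) → SatClause (extend φ α) C
  backward sat with find sat
  ... | (v , b) , x∈ , satx =
    let (x∈C , kept) = ∈-filter⁻ (kept? φ) x∈
    in lose x∈C (trans (extend-unassigned φ v
                          (unassigned φ v b (untouched-lit φ untouched x∈C) (to T-not kept))) satx)

sat-*⇔ : ∀ φ α G → SatCls α (φ * G) ⇔ SatCls (extend φ α) G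
sat-*⇔ φ α G = mk⇔ forward backward
  where
  forward : SatCls α (φ * G) → SatCls (extend φ α) G
  forward sat = All.tabulate λ {C} C∈G → by-cases C∈G (T? (any (litTrue φ) C))
    where
    by-cases : ∀ {C} → C ∈ G → Dec (T (any (litTrue φ) C)) → SatClause (extend φ α) C
    by-cases {C} _ (yes touched) =
      let (x , x∈C , tx) = find (any⁻ (litTrue φ) C touched) in lose x∈C (litTrue-sat φ x tx)
    by-cases C∈G (no ¬touched) =
      from (sat-restrict⇔ φ (from T-not ¬touched)) (All.lookup sat (∈-*⁺ φ C∈G (from T-not ¬touched)))

  backward : SatCls (extend φ α) G → SatCls α (φ * G)
  backward sat = All.tabulate restricted
    where
    restricted : ∀ {D} → D ∈ φ * G → SatClause α D
    restricted D∈ with ∈-*⁻ φ D∈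
    ... | _ , C∈G , refl , untouched = to (sat-restrict⇔ φ untouched) (All.lookup sat C∈G)

falsifier : Clause → PartialAssignment
falsifier C v with (v , true) ∈? C
... | yes _ = just false
... | no _ with (v , false) ∈? C
...   | yes _ = just true
...   | no _  = nothing

falsifier-∈ : ∀ {C v b} → IsClause C → (v , b) ∈ C → falsifier C v ≡ just (not b)
falsifier-∈ {C} {v} x∈C _ with (v , true) ∈? C
falsifier-∈ {b = true}  _              _   | yes _   = refl
falsifier-∈ {b = false} (_ , noCompl) x∈C | yes t∈C = ⊥-elim (noCompl _ x∈C t∈C)
falsifier-∈ {b = true}  _              x∈C | no t∉C  = ⊥-elim (t∉C x∈C)
falsifier-∈ {C} {v} {false} _          x∈C | no _ with (v , false) ∈? C
... | yes _   = refl
... | no f∉C  = ⊥-elim (f∉C x∈C)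

falsifier-just : ∀ {C v a} → falsifier C v ≡ just a → (v , not a) ∈ C
falsifier-just {C} {v} eq with (v , true) ∈? C
falsifier-just refl | yes t∈C = t∈C
falsifier-just {C} {v} eq | no _ with (v , false) ∈? C
falsifier-just refl | no _ | yes f∈C = f∈C
falsifier-just ()   | no _ | no _

T-litFalse-falsifier : ∀ {C} x → IsClause C → T (litFalse (falsifier C) x) ⇔ x ∈ C
T-litFalse-falsifier {C} (v , b) clause = mk⇔
  (λ t → subst (λ c → (v , c) ∈ C) (not-involutive b)
                (falsifier-just (to (T-litFalse (falsifier C) v b) t)))
  (λ x∈C → from (T-litFalse (falsifier C) v b) (falsifier-∈ clause x∈C))

litTrue-falsifier : ∀ {C} x → IsClause C → compl x ∈ C → T (litTrue (falsifier C) x)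
litTrue-falsifier {C} (v , b) clause x̄∈C =
  from (T-litTrue (falsifier C) v b) (trans (falsifier-∈ clause x̄∈C) (cong just (not-involutive b)))

falsifier-falsifies : ∀ {C α} → IsClause C → ¬ SatClause (extend (falsifier C) α) C
falsifier-falsifies {C} {α} clause sat =
  let (x , x∈C , satx) = find sat
  in litFalse-unsat (falsifier C) x (from (T-litFalse-falsifier x clause) x∈C) satx

length-restrict-falsifier : ∀ {C} C′ → IsClause C → length (restrict (falsifier C) C′) ≡ diffSize C′ C
length-restrict-falsifier {C} C′ clause = cong length
  (filter-≐ (kept? (falsifier C)) (λ x → ¬? (x ∈? C))
    ((λ {x} kept → to T-not kept ∘ from (T-litFalse-falsifier x clause)) ,
     (λ {x} x∉C → from T-not (x∉C ∘ to (T-litFalse-falsifier x clause))))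
    C′)

AgreeOn : Clause → Assignment → Assignment → Set
AgreeOn xs α β = ∀ {v b} → (v , b) ∈ xs → α v ≡ β v

update : ℕ → Bool → Assignment → Assignment
update w b β u with u ≟ℕ w
... | yes _ = b
... | no _  = β u

update-agree : ∀ {w c xs α β} → AgreeOn xs α β → AgreeOn ((w , c) ∷ xs) α (update w (α w) β)
update-agree {w} agree {u} u∈ with u ≟ℕ w | u∈
... | yes refl | _             = refl
... | no u≢w   | here refl     = ⊥-elim (u≢w refl)
... | no _     | there u∈xs    = agree u∈xs

assignmentsOn : Clause → List Assignment
assignmentsOn []             = (λ _ → false) ∷ []
assignmentsOn ((w , _) ∷ xs) =
  map (update w true) (assignmentsOn xs) ++ map (update w false) (assignmentsOn xs)

update-∈ : ∀ {w c xs β} b → β ∈ assignmentsOn xs → update w b β ∈ assignmentsOn ((w , c) ∷ xs)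
update-∈ {w} true  β∈ = ∈-++⁺ˡ (∈-map⁺ (update w true) β∈)
update-∈ {w} false β∈ = ∈-++⁺ʳ _ (∈-map⁺ (update w false) β∈)

assignmentsOn-complete : ∀ xs α → ∃[ β ] (β ∈ assignmentsOn xs × AgreeOn xs α β)
assignmentsOn-complete []             α = _ , here refl , λ ()
assignmentsOn-complete ((w , c) ∷ xs) α =
  let (β , β∈ , agree) = assignmentsOn-complete xs α
  in update w (α w) β , update-∈ {c = c} {xs} (α w) β∈ , update-agree {w} agree

Local : Clause → (Assignment → Set) → Set
Local xs P = ∀ {α β} → AgreeOn xs α β → P α → P β

∃-assignment? : ∀ xs {P : Assignment → Set} → Local xs P → (∀ α → Dec (P α)) → Dec (∃ P)
∃-assignment? xs local P? with any? P? (assignmentsOn xs)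
... | yes some = let (β , _ , p) = find some in yes (β , p)
... | no none  = no λ (α , p) →
  let (β , β∈ , agree) = assignmentsOn-complete xs α in none (lose β∈ (local agree p))

SatClause-local : ∀ C → Local C (λ α → SatClause α C)
SatClause-local C agree sat =
  let ((v , b) , x∈C , satx) = find sat in lose x∈C (trans (sym (agree x∈C)) satx)

SatCls-local : ∀ F → Local (concat F) (λ α → SatCls α F)
SatCls-local F agree sat = All.tabulate λ C∈F →
  SatClause-local _ (λ x∈C → agree (∈-concat⁺′ x∈C C∈F)) (All.lookup sat C∈F)

SatClause? : ∀ α C → Dec (SatClause α C)
SatClause? α = any? λ (v , b) → α v ≟𝔹 b

SatCls? : ∀ α F → Dec (SatCls α F)
SatCls? α = all? (SatClause? α)

satisfiable? : ∀ F → Dec (Satisfiable F)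
satisfiable? F = ∃-assignment? (concat F) (SatCls-local F) (λ α → SatCls? α F)

entails? : ∀ F C → Dec (F ⊨ C)
entails? F C with ∃-assignment? (C ++ concat F) local (λ α → SatCls? α F ×-dec ¬? (SatClause? α C))
  where
  local : Local (C ++ concat F) (λ α → SatCls α F × ¬ SatClause α C)
  local agree (sat , unsat) =
    SatCls-local F (agree ∘ ∈-++⁺ʳ C) sat ,
    unsat ∘ SatClause-local C (sym ∘ agree ∘ ∈-++⁺ˡ)
... | yes (α , sat , unsat) = no λ entails → unsat (entails α sat)
... | no none = yes λ α sat → decidable-stable (SatClause? α C) λ unsat → none (α , sat , unsat)

_≢?_ : ∀ (y x : Lit) → Dec (y ≢ x)
y ≢? x = ¬? (y ≟L x)

remove : Lit → Clause → Clause
remove x = filter (_≢? x)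

remove-shorter : ∀ {x C} → x ∈ C → length (remove x C) < length C
remove-shorter {x} {C} x∈C = filter-notAll (_≢? x) C (lose x∈C λ x≢x → x≢x refl)

IsClause-filter : ∀ {P : Lit → Set} (P? : ∀ x → Dec (P x)) {C} → IsClause C → IsClause (filter P? C)
IsClause-filter P? (unique , noCompl) =
  Unique.filter⁺ P? unique ,
  λ x x∈ x̄∈ → noCompl x (proj₁ (∈-filter⁻ P? x∈)) (proj₁ (∈-filter⁻ P? x̄∈))

⊨-⊆ : ∀ {F C D} → F ⊨ D → D ⊆ C → F ⊨ C
⊨-⊆ entails D⊆C α sat = Any-resp-⊆ D⊆C (entails α sat)

module _ (F : ClauseSet) where

  minimise : ∀ n C → length C ≤ n → IsClause C → F ⊨ C → ∃[ C′ ] (C′ ⊆ C × IsPrimeImplicate F C′)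
  minimise n C len clause entails with any? (λ x → entails? F (remove x C)) C
  ... | no irredundant = C , (λ x∈ → x∈) , clause , entails , minimal
    where
    minimal : ∀ D → IsClause D → D ⊆ C → F ⊨ D → C ⊆ D
    minimal D _ D⊆C entailsD {x} x∈C with x ∈? D
    ... | yes x∈D = x∈D
    ... | no x∉D  = ⊥-elim (irredundant (lose x∈C (⊨-⊆ entailsD λ y∈D →
          ∈-filter⁺ (_≢? x) (D⊆C y∈D) λ { refl → x∉D y∈D })))
  ... | yes redundant with find redundant
  ... | x , x∈C , entails′ with <-≤-trans (remove-shorter x∈C) len
  ... | s≤s len′ =
    let (C′ , C′⊆ , prime) = minimise _ (remove x C) len′ (IsClause-filter _ clause) entails′
    in C′ , filter-⊆ _ C ∘ C′⊆ , prime

  prime-implicate-⊆ : ∀ {D} → IsClause D → F ⊨ D → ∃[ C ] (C ⊆ D × IsPrimeImplicate F C)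
  prime-implicate-⊆ {D} = minimise (length D) D ≤-refl

prime-implicate-unsat : ∀ {F C} → Unsatisfiable F → IsPrimeImplicate F C → C ≡ []
prime-implicate-unsat unsat (_ , _ , minimal) =
  ⊆[]⇒≡[] (minimal [] ([] , λ _ ()) (λ ()) λ α sat → ⊥-elim (unsat α sat))

Unique-⊆⇒length≤ : ∀ {xs ys : Clause} → Unique xs → xs ⊆ ys → length xs ≤ length ys
Unique-⊆⇒length≤ {[]}     _                _    = z≤n
Unique-⊆⇒length≤ {x ∷ xs} (x∉xs ∷ unique) xs⊆ys =
  <-≤-trans (s≤s (Unique-⊆⇒length≤ unique λ y∈xs →
              ∈-filter⁺ (_≢? x) (xs⊆ys (there y∈xs)) λ { refl → All.lookup x∉xs y∈xs refl }))
            (remove-shorter (xs⊆ys (here refl)))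

resolve : Lit → Clause → Clause → Clause
resolve x C₁ C₂ = remove x C₁ ++ filter (λ y → ¬? (y ∈? remove x C₁)) (remove (compl x) C₂)

∈-resolve⇔ : ∀ {x C₁ C₂} y → y ∈ resolve x C₁ C₂ ⇔ ((y ∈ C₁ × y ≢ x) ⊎ (y ∈ C₂ × y ≢ compl x))
∈-resolve⇔ {x} {C₁} {C₂} y = mk⇔ forward backward
  where
  new? = λ y → ¬? (y ∈? remove x C₁)

  forward : y ∈ resolve x C₁ C₂ → (y ∈ C₁ × y ≢ x) ⊎ (y ∈ C₂ × y ≢ compl x)
  forward y∈ with ∈-++⁻ (remove x C₁) y∈
  ... | inj₁ y∈₁ = inj₁ (∈-filter⁻ (_≢? x) y∈₁)
  ... | inj₂ y∈₂ = inj₂ (∈-filter⁻ (_≢? compl x) (proj₁ (∈-filter⁻ new? y∈₂)))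

  backward : (y ∈ C₁ × y ≢ x) ⊎ (y ∈ C₂ × y ≢ compl x) → y ∈ resolve x C₁ C₂
  backward (inj₁ (y∈C₁ , y≢x)) = ∈-++⁺ˡ (∈-filter⁺ (_≢? x) y∈C₁ y≢x)
  backward (inj₂ (y∈C₂ , y≢x̄)) with y ∈? remove x C₁
  ... | yes y∈₁ = ∈-++⁺ˡ y∈₁
  ... | no y∉₁  = ∈-++⁺ʳ (remove x C₁) (∈-filter⁺ new? (∈-filter⁺ (_≢? compl x) y∈C₂ y≢x̄) y∉₁)

Unique-resolve : ∀ {x C₁ C₂} → Unique C₁ → Unique C₂ → Unique (resolve x C₁ C₂)
Unique-resolve {x} {C₁} {C₂} unique₁ unique₂ =
  Unique.++⁺ (Unique.filter⁺ _ unique₁) (Unique.filter⁺ _ (Unique.filter⁺ _ unique₂))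
    λ (y∈₁ , y∈₂) → proj₂ (∈-filter⁻ (λ y → ¬? (y ∈? remove x C₁)) {xs = remove (compl x) C₂} y∈₂) y∈₁

resolvent-⊆ˡ : ∀ {x C₁ C₂ R R₁} → Resolvent x C₁ C₂ R → R₁ ⊆ C₁ → x ∉ R₁ → R₁ ⊆ R
resolvent-⊆ˡ (_ , _ , _ , ∈R⇔) R₁⊆C₁ x∉R₁ {y} y∈R₁ =
  from (∈R⇔ y) (inj₁ (R₁⊆C₁ y∈R₁ , λ { refl → x∉R₁ y∈R₁ }))

resolvent-⊆ʳ : ∀ {x C₁ C₂ R R₂} → Resolvent x C₁ C₂ R → R₂ ⊆ C₂ → compl x ∉ R₂ → R₂ ⊆ R
resolvent-⊆ʳ (_ , _ , _ , ∈R⇔) R₂⊆C₂ x̄∉R₂ {y} y∈R₂ =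
  from (∈R⇔ y) (inj₂ (R₂⊆C₂ y∈R₂ , λ { refl → x̄∉R₂ y∈R₂ }))

resolvent-⊆ : ∀ {x C₁ C₂ R R₁ R₂} → Resolvent x C₁ C₂ R → R₁ ⊆ C₁ → R₂ ⊆ C₂ →
  IsClause R₁ → IsClause R₂ → x ∈ R₁ → compl x ∈ R₂ →
  Resolvent x R₁ R₂ (resolve x R₁ R₂) × resolve x R₁ R₂ ⊆ R
resolvent-⊆ {x} {R = R} {R₁} {R₂} (_ , _ , (_ , noCompl) , ∈R⇔) R₁⊆C₁ R₂⊆C₂
            (unique₁ , _) (unique₂ , _) x∈R₁ x̄∈R₂ =
  (x∈R₁ , x̄∈R₂ , (Unique-resolve unique₁ unique₂ , λ y y∈ ȳ∈ → noCompl y (⊆R y∈) (⊆R ȳ∈)) , ∈-resolve⇔) ,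
  ⊆R
  where
  ⊆R : resolve x R₁ R₂ ⊆ R
  ⊆R {y} y∈ = from (∈R⇔ y) (Sum.map (map₁ R₁⊆C₁) (map₁ R₂⊆C₂) (to (∈-resolve⇔ y) y∈))

Resolvent-IsClause : ∀ {x C₁ C₂ R} → Resolvent x C₁ C₂ R → IsClause R
Resolvent-IsClause (_ , _ , clause , _) = clause

Subsumes : ClauseSet → ClauseSet → Set
Subsumes G′ G = ∀ {C} → C ∈ G → ∃[ C′ ] (C′ ∈ G′ × C′ ⊆ C)

subsumes-sat : ∀ {G G′ α} → Subsumes G′ G → SatCls α G′ → SatCls α G
subsumes-sat subsumes sat = All.tabulate λ C∈G →
  let (C′ , C′∈G′ , C′⊆C) = subsumes C∈G in Any-resp-⊆ C′⊆C (All.lookup sat C′∈G′)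

entailed-sat : ∀ {F G α} → All (F ⊨_) G → SatCls α F → SatCls α G
entailed-sat {α = α} entailed sat = All.map (λ entails → entails α sat) entailed

Deriv-subsumed : ∀ {k G G′ R} → All IsClause G′ → Subsumes G′ G → Deriv k G R →
  ∃[ R′ ] (R′ ⊆ R × IsClause R′ × Deriv k G′ R′)
Deriv-subsumed clauses subsumes (axiom R∈G) =
  let (R′ , R′∈G′ , R′⊆R) = subsumes R∈G in R′ , R′⊆R , All.lookup clauses R′∈G′ , axiom R′∈G′
Deriv-subsumed {k} clauses subsumes (res {x} d₁ d₂ resolvent narrow)
  with Deriv-subsumed clauses subsumes d₁ | Deriv-subsumed clauses subsumes d₂
... | R₁ , R₁⊆C₁ , clause₁ , d₁′ | R₂ , R₂⊆C₂ , clause₂ , d₂′ with x ∈? R₁ | compl x ∈? R₂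
...   | no x∉R₁ | _ = R₁ , resolvent-⊆ˡ resolvent R₁⊆C₁ x∉R₁ , clause₁ , d₁′
...   | yes _ | no x̄∉R₂ = R₂ , resolvent-⊆ʳ resolvent R₂⊆C₂ x̄∉R₂ , clause₂ , d₂′
...   | yes x∈R₁ | yes x̄∈R₂ =
  let (resolvent′ , ⊆R) = resolvent-⊆ resolvent R₁⊆C₁ R₂⊆C₂ clause₁ clause₂ x∈R₁ x̄∈R₂
  in resolve x R₁ R₂ , ⊆R , Resolvent-IsClause resolvent′ ,
     res d₁′ d₂′ resolvent′ (Sum.map (shrink clause₁ R₁⊆C₁) (shrink clause₂ R₂⊆C₂) narrow)
  where
  shrink : ∀ {R C} → IsClause R → R ⊆ C → length C ≤ k → length R ≤ k
  shrink (unique , _) R⊆C = ≤-trans (Unique-⊆⇒length≤ unique R⊆C)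

refutation-subsumed : ∀ {k G G′} → All IsClause G′ → Subsumes G′ G → Refutable k G → Refutable k G′
refutation-subsumed clauses subsumes refutation =
  let (R′ , R′⊆[] , _ , d′) = Deriv-subsumed clauses subsumes refutation
  in subst (Deriv _ _) (⊆[]⇒≡[] R′⊆[]) d′

short-axiom : ∀ {k G R} → Deriv k G R → length R ≤ k → ∃[ D ] (D ∈ G × length D ≤ k)
short-axiom (axiom R∈G)                 short  = _ , R∈G , short
short-axiom (res d₁ _ _ (inj₁ short₁)) _      = short-axiom d₁ short₁
short-axiom (res _ d₂ _ (inj₂ short₂)) _      = short-axiom d₂ short₂

*-IsClause : ∀ φ {G} → All IsClause G → All IsClause (φ * G)
*-IsClause φ clauses = All.tabulate λ D∈ →
  let (C , C∈G , D≡ , _) = ∈-*⁻ φ D∈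
  in subst IsClause (sym D≡) (IsClause-filter (kept? φ) (All.lookup clauses C∈G))

*-subsumes : ∀ φ {G G′} → Subsumes G′ G → Subsumes (φ * G′) (φ * G)
*-subsumes φ subsumes D∈ with ∈-*⁻ φ D∈
... | C , C∈G , refl , untouched =
  let (C′ , C′∈G′ , C′⊆C) = subsumes C∈G
  in restrict φ C′ , ∈-*⁺ φ C′∈G′ (untouched-⊆ φ untouched C′⊆C) ,
     filter⁺′ (kept? φ) (kept? φ) id C′⊆C

WhdLe-subsuming : ∀ {k G G′} → All IsClause G′ → Subsumes G′ G → (∀ α → SatCls α G → SatCls α G′) →
  WhdLe G k → WhdLe G′ k
WhdLe-subsuming {G = G} {G′} clauses subsumes implies (refute , refute-*) = refute′ , refute-*′
  where
  refute′ : Unsatisfiable G′ → Refutable _ G′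
  refute′ unsat′ = refutation-subsumed clauses subsumes (refute λ α sat → unsat′ α (implies α sat))

  refute-*′ : Satisfiable G′ → ∀ φ → Unsatisfiable (φ * G′) → Refutable _ (φ * G′)
  refute-*′ (α , sat′) φ unsat′ =
    refutation-subsumed (*-IsClause φ clauses) (*-subsumes φ subsumes)
      (refute-* (α , subsumes-sat subsumes sat′) φ λ β sat →
        unsat′ β (from (sat-*⇔ φ β G′) (implies _ (to (sat-*⇔ φ β G) sat))))

falsifier-unsat : ∀ {G C} → IsClause C → G ⊨ C → Unsatisfiable (falsifier C * G)
falsifier-unsat {G} {C} clause entails α sat =
  falsifier-falsifies clause (entails _ (to (sat-*⇔ (falsifier C) α G) sat))

hyperedge-hit : ∀ {k G C} → Satisfiable G → WhdLe G k → IsClause C → G ⊨ C →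
  ∃[ C′ ] (C′ ∈ G × InHyperedge k C C′)
hyperedge-hit {k} {G} {C} sat (_ , refute-*) clause entails
  with short-axiom (refute-* sat (falsifier C) (falsifier-unsat clause entails)) z≤n
... | D , D∈ , short with ∈-*⁻ (falsifier C) D∈
...   | C′ , C′∈G , refl , untouched =
  C′ , C′∈G , disjoint , subst (_≤ k) (length-restrict-falsifier C′ clause) short
  where
  disjoint : ∀ x → x ∈ C′ → compl x ∈ C → ⊥
  disjoint x x∈C′ x̄∈C = untouched-lit (falsifier C) untouched x∈C′ (litTrue-falsifier x clause x̄∈C)

InHyperedge-[] : ∀ {k C} → InHyperedge k C []
InHyperedge-[] = (λ _ ()) , z≤n

Unsatisfiable⇒nonempty : ∀ {G} → Unsatisfiable G → ∃[ C ] (C ∈ G)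
Unsatisfiable⇒nonempty {[]}    unsat = ⊥-elim (unsat (λ _ → false) [])
Unsatisfiable⇒nonempty {C ∷ _} _     = C , here refl

transversal : ∀ {k F G} → Equivalent F G → All (IsPrimeImplicate F) G → WhdLe G k → IsTransversal k F G
transversal {k} {F} {G} equivalent primes whd = primes , hit
  where
  hit : ∀ C → IsPrimeImplicate F C → ∃[ C′ ] (C′ ∈ G × IsPrimeImplicate F C′ × InHyperedge k C C′)
  hit C (clause , entails , _) with satisfiable? G
  ... | yes sat =
    let (C′ , C′∈G , hit′) = hyperedge-hit sat whd clause λ α → entails α ∘ from (equivalent α)
    in C′ , C′∈G , All.lookup primes C′∈G , hit′
  ... | no unsat =
    let (C′ , C′∈G) = Unsatisfiable⇒nonempty λ α sat → unsat (α , sat)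
        prime = All.lookup primes C′∈G
        C′≡[] = prime-implicate-unsat (λ α sat → unsat (α , to (equivalent α) sat)) prime
    in C′ , C′∈G , prime , subst (InHyperedge k C) (sym C′≡[]) InHyperedge-[]

module _ {A B : Set} {R : A → B → Set} where

  index : ∀ {xs ys} → Sublist R xs ys → Fin (length xs) → Fin (length ys)
  index (_ ∷ʳ s) j       = suc (index s j)
  index (_ ∷ s)  zero    = zero
  index (_ ∷ s)  (suc j) = suc (index s j)

  index-injective : ∀ {xs ys} (s : Sublist R xs ys) → Injective _≡_ _≡_ (index s)
  index-injective (_ ∷ʳ s) eq = index-injective s (suc-injective eq)
  index-injective (_ ∷ s) {zero}  {zero}  _  = refl
  index-injective (_ ∷ s) {suc i} {suc j} eq = cong suc (index-injective s (suc-injective eq))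

  index-related : ∀ {xs ys} (s : Sublist R xs ys) j → R (lookup xs j) (lookup ys (index s j))
  index-related (_ ∷ʳ s) j       = index-related s j
  index-related (r ∷ _)  zero    = r
  index-related (_ ∷ s)  (suc j) = index-related s j

_≋?_ : ∀ C D → Dec (C ≋ D)
C ≋? D = (C ⊆? D) ×-dec (D ⊆? C)

subsumes-∷ : ∀ {C C′ G G′} → C′ ∈ G′ → C′ ⊆ C → Subsumes G′ G → Subsumes G′ (C ∷ G)
subsumes-∷ C′∈G′ C′⊆C _        (here refl) = _ , C′∈G′ , C′⊆C
subsumes-∷ _     _    subsumes (there C∈G) = subsumes C∈G

subsumes-there : ∀ {C G G′} → Subsumes G′ G → Subsumes (C ∷ G′) G
subsumes-there subsumes C∈G = let (C′ , C′∈G′ , C′⊆C) = subsumes C∈G in C′ , there C′∈G′ , C′⊆C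

record PrimeReduction (F G : ClauseSet) : Set where
  field
    clauses   : ClauseSet
    embedding : Sublist _⊆_ clauses G
    primes    : All (IsPrimeImplicate F) clauses
    distinct  : AllPairs (λ C D → ¬ (C ≋ D)) clauses
    subsumes  : Subsumes clauses G

primeReduction : ∀ F G → All IsClause G → All (F ⊨_) G → PrimeReduction F G
primeReduction F [] _ _ =
  record { clauses = [] ; embedding = [] ; primes = [] ; distinct = [] ; subsumes = λ () }
primeReduction F (D ∷ G) (clauseD ∷ clausesG) (entailsD ∷ entailedG)
  with primeReduction F G clausesG entailedG | prime-implicate-⊆ F clauseD entailsD
... | reduction | C , C⊆D , prime with any? (C ≋?_) (PrimeReduction.clauses reduction)
...   | yes repeated =
  let (E , E∈ , _ , E⊆C) = find repeated
  in record
    { clauses   = clauses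
    ; embedding = D ∷ʳ embedding
    ; primes    = primes
    ; distinct  = distinct
    ; subsumes  = subsumes-∷ E∈ (C⊆D ∘ E⊆C) subsumes
    }
  where open PrimeReduction reduction
...   | no new = record
  { clauses   = C ∷ clauses
  ; embedding = C⊆D ∷ embedding
  ; primes    = prime ∷ primes
  ; distinct  = All.tabulate (λ E∈ C≋E → new (lose E∈ C≋E)) ∷ distinct
  ; subsumes  = subsumes-∷ (here refl) C⊆D (subsumes-there subsumes)
  }
  where open PrimeReduction reduction

lemma6p3 : (k : ℕ) (F : ClauseSet) → IsClauseSet F → WhdLe F k →
    ∃[ F' ] (IsClauseSet F' ×
      All (IsPrimeImplicate F) F' × Equivalent F F' ×
      (Σ (Fin (length F') → Fin (length F)) λ i →
         Injective _≡_ _≡_ i × (∀ j → lookup F' j ⊆ lookup F (i j))) ×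
      WhdLe F' k ×
      IsTransversal k F F')
lemma6p3 k F (clausesF , _) whd =
  clauses , (clausesF′ , distinct) , primes , equivalent ,
  (index embedding , index-injective embedding , index-related embedding) ,
  whd′ , transversal equivalent primes whd′
  where
  open PrimeReduction (primeReduction F F clausesF (All.tabulate λ C∈F α sat → All.lookup sat C∈F))

  clausesF′ : All IsClause clauses
  clausesF′ = All.map proj₁ primes

  equivalent : Equivalent F clauses
  equivalent α = mk⇔ (entailed-sat (All.map (proj₁ ∘ proj₂) primes)) (subsumes-sat subsumes)

  whd′ : WhdLe clauses k
  whd′ = WhdLe-subsuming clausesF′ subsumes (λ α → to (equivalent α)) whd
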